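{- Let $\mathcal{B},\mathcal{C}$ be $\sqrt{\mathfrak{gl}_n}$-crystals. Then the set $\mathcal{B}\otimes\mathcal{C}=\{b\otimes c: b\in\mathcal{B}, c\in\mathcal{C}\}$ is a $\sqrt{\mathfrak{gl}_n}$-crystal with $\operatorname{wt}(b\otimes c)=\operatorname{wt}(b)+\operatorname{wt}(c)$ and, for $i\in[n-1]$, $e'_i(b\otimes c)=b\otimes e'_i(c)$ if $\varepsilon'_i(b)\le\varphi'_i(c)$ and $=e'_i(b)\otimes c$ otherwise; $f'_i(b\otimes c)=b\otimes f'_i(c)$ if $\varepsilon'_i(b)<\varphi'_i(c)$ and $=f'_i(b)\otimes c$ otherwise (with $b\otimes0=0\otimes c=0$). If $\mathcal{B},\mathcal{C}$ are $\sqrt{\mathfrak{q}_n}$-crystals, then $\mathcal{B}\otimes\mathcal{C}$ is moreover a $\sqrt{\mathfrak{q}_n}$-crystal with $e'_{\overline1}(b\otimes c)=b\otimes e'_{\overline1}(c)$ and $f'_{\overline1}(b\otimes c)=b\otimes f'_{\overline1}(c)$ if $\operatorname{wt}(b)_1=\operatorname{wt}(b)_2=0$, and $e'_{\overline1}(b\otimes c)=e'_{\overline1}(b)\otimes c$, $f'_{\overline1}(b\otimes c)=f'_{\overline1}(b)\otimes c$ otherwise. Finally, for $\sqrt{\mathfrak{gl}_n}$-crystals (resp. $\sqrt{\mathfrak{q}_n}$-crystals) $\mathcal{B},\mathcal{C},\mathcal{D}$, the natural map $\mathcal{B}\otimes(\mathcal{C}\otimes\mathcal{D})\to(\mathcal{B}\otimes\mathcal{C})\otimes\mathcal{D}$,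 $b\otimes(c\otimes d)\mapsto(b\otimes c)\otimes d$, is an isomorphism of $\sqrt{\mathfrak{gl}_n}$-crystals (resp. $\sqrt{\mathfrak{q}_n}$-crystals).
   Context: Let $n\ge2$. A $\sqrt{\mathfrak{gl}_n}$-crystal is a set $\mathcal{B}$ with $\operatorname{wt}:\mathcal{B}\to\mathbb{N}^n$ and maps $e'_i,f'_i:\mathcal{B}\to\mathcal{B}\sqcup\{0\}$ for $i\in[n-1]$ ($0\notin\mathcal{B}$, and all maps send $0$ to $0$); set $\varepsilon'_i(b)=\sup\{k\ge0:(e'_i)^k(b)\ne0\}$, $\varphi'_i(b)=\sup\{k\ge0:(f'_i)^k(b)\ne0\}$. Require for all $i$ and $b,c\in\mathcal{B}$: (a) $\varepsilon'_i(b)+\varphi'_i(b)\in2\mathbb{N}$ and $\frac{\varphi'_i(b)-\varepsilon'_i(b)}2=\operatorname{wt}(b)_i-\operatorname{wt}(b)_{i+1}$; (b) $e'_i(b)=c$ iff $b=f'_i(c)$, in which case $\operatorname{wt}(c)-\operatorname{wt}(b)$ is $\mathbf{e}_i$ if $\varepsilon'_i(b)$ is even and $-\mathbf{e}_{i+1}$ if odd ($\mathbf{e}_j$ standard basis vectors). A $\sqrt{\mathfrak{q}_n}$-crystal is a $\sqrt{\mathfrak{gl}_n}$-crystal with extra maps $e'_{\overline1},f'_{\overline1}:\mathcal{B}\to\mathcal{B}\sqcup\{0\}$ (with $\varepsilon'_{\overline1},\varphi'_{\overline1}$ defined analogously) that commute with $e'_i,f'_i$ and preserve $\varepsilon'_i,\varphi'_i$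 (values unchanged when the image is nonzero) for $3\le i\le n-1$, such that (a) $\varepsilon'_{\overline1}(b)+\varphi'_{\overline1}(b)$ is $0$ if $\operatorname{wt}(b)_1=\operatorname{wt}(b)_2=0$ and $2$ otherwise; (b) $e'_{\overline1}(b)=c$ iff $b=f'_{\overline1}(c)$, in which case $\operatorname{wt}(c)-\operatorname{wt}(b)$ is $\mathbf{e}_1$ if $\varepsilon'_{\overline1}(b)=2$ and $-\mathbf{e}_2$ if $\varepsilon'_{\overline1}(b)=1$. An isomorphism of such crystals is a weight-preserving bijection commuting with all the operators $e'_i,f'_i$ (including $i=\overline1$ in the $\sqrt{\mathfrak{q}_n}$ case), i.e. a weight-preserving isomorphism of the labeled crystal graphs. -}

module Defs where

open import Data.Nat using (ℕ; zero; suc; _+_; _*_; _≤_; _≤ᵇ_; _<ᵇ_; _≡ᵇ_)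
open import Data.Integer as ℤ using (ℤ; +_)
open import Data.Fin as Fin using (Fin; zero; suc; inject₁; toℕ)
open import Data.Vec using (Vec; lookup; zipWith; tabulate)
open import Data.Maybe using (Maybe; just; nothing; map; _>>=_)
open import Data.Product using (Σ; ∃-syntax; _×_; _,_)
open import Data.Bool using (Bool; if_then_else_; _∧_)
open import Relation.Binary.PropositionalEquality using (_≡_; _≢_)
open import Relation.Nullary using (¬_)
open import Relation.Nullary.Decidable using (⌊_⌋)
open import Function using (_⇔_; Bijective)

-- Convention: n = suc (suc k), i.e. n ≥ 2 is encoded by n = k + 2.
-- Weights live in ℕ^n.
Wt : ℕ → Set
Wt k = Vec ℕ (suc (suc k))

unit : ∀ {k} → Fin (suc (suc k)) → Wt k
unit j = tabulate (λ l → if ⌊ l Fin.≟ j ⌋ then 1 else 0)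

infixl 6 _⊕_
_⊕_ : ∀ {k} → Wt k → Wt k → Wt k
_⊕_ = zipWith _+_

-- Operators B → B ⊔ {0} are modelled as B → Maybe B (nothing = 0).
-- Index i : Fin (suc k) stands for the 1-based index i+1 ∈ [n-1];
-- then wt_i is lookup w (inject₁ i) and wt_{i+1} is lookup w (suc i).
wtᵢ wtᵢ₊₁ : ∀ {k} → Wt k → Fin (suc k) → ℕ
wtᵢ w i = lookup w (inject₁ i)
wtᵢ₊₁ w i = lookup w (suc i)

iter : {B : Set} → (B → Maybe B) → ℕ → B → Maybe B
iter g zero b = just b
iter g (suc j) b = iter g j b >>= g

IsSup : {B : Set} → (B → Maybe B) → B → ℕ → Set
IsSup g b m = ∀ j → (j ≤ m ⇔ iter g j b ≢ nothing)

Even Odd : ℕ → Set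
Even m = ∃[ t ] (m ≡ 2 * t)
Odd m = ∃[ t ] (m ≡ suc (2 * t))

record IsGlCrystal {k : ℕ} {B : Set} (wt : B → Wt k)
                   (e f : Fin (suc k) → B → Maybe B) : Set where
  field
    ε φ : Fin (suc k) → B → ℕ
    ε-sup : ∀ i b → IsSup (e i) b (ε i b)
    φ-sup : ∀ i b → IsSup (f i) b (φ i b)
    sum-even : ∀ i b → Even (ε i b + φ i b)
    half-diff : ∀ i b → (+ φ i b) ℤ.- (+ ε i b)
                        ≡ + 2 ℤ.* ((+ wtᵢ (wt b) i) ℤ.- (+ wtᵢ₊₁ (wt b) i))
    e⇔f : ∀ i b c → (e i b ≡ just c) ⇔ (f i c ≡ just b)
    wt-even : ∀ i b c → e i b ≡ just c → Even (ε i b) → wt c ≡ wt b ⊕ unit (inject₁ i)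
    wt-odd : ∀ i b c → e i b ≡ just c → Odd (ε i b) → wt b ≡ wt c ⊕ unit (suc i)

record GlCrystal (k : ℕ) : Set₁ where
  field
    Carrier : Set
    wt : Carrier → Wt k
    e f : Fin (suc k) → Carrier → Maybe Carrier
    isGl : IsGlCrystal wt e f
  open IsGlCrystal isGl public

wt₁ wt₂ : ∀ {k} → Wt k → ℕ
wt₁ w = lookup w zero
wt₂ w = lookup w (suc zero)

record IsQCrystal {k : ℕ} {B : Set} (wt : B → Wt k)
                  (e f : Fin (suc k) → B → Maybe B)
                  (e̅ f̅ : B → Maybe B) : Set where
  field
    isGl : IsGlCrystal wt e f
  open IsGlCrystal isGl
  field
    ε̅ φ̅ : B → ℕ
    ε̅-sup : ∀ b → IsSup e̅ b (ε̅ b)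
    φ̅-sup : ∀ b → IsSup f̅ b (φ̅ b)
    -- commutation with e'_i, f'_i for 3 ≤ i ≤ n-1 (1-based), i.e. 2 ≤ toℕ i
    comm-e̅e : ∀ i → 2 ≤ toℕ i → ∀ b → (e̅ b >>= e i) ≡ (e i b >>= e̅)
    comm-e̅f : ∀ i → 2 ≤ toℕ i → ∀ b → (e̅ b >>= f i) ≡ (f i b >>= e̅)
    comm-f̅e : ∀ i → 2 ≤ toℕ i → ∀ b → (f̅ b >>= e i) ≡ (e i b >>= f̅)
    comm-f̅f : ∀ i → 2 ≤ toℕ i → ∀ b → (f̅ b >>= f i) ≡ (f i b >>= f̅)
    pres-e̅ : ∀ i → 2 ≤ toℕ i → ∀ b c → e̅ b ≡ just c → (ε i c ≡ ε i b) × (φ i c ≡ φ i b)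
    pres-f̅ : ∀ i → 2 ≤ toℕ i → ∀ b c → f̅ b ≡ just c → (ε i c ≡ ε i b) × (φ i c ≡ φ i b)
    sum-zero : ∀ b → wt₁ (wt b) ≡ 0 → wt₂ (wt b) ≡ 0 → ε̅ b + φ̅ b ≡ 0
    sum-two : ∀ b → ¬ (wt₁ (wt b) ≡ 0 × wt₂ (wt b) ≡ 0) → ε̅ b + φ̅ b ≡ 2
    e̅⇔f̅ : ∀ b c → (e̅ b ≡ just c) ⇔ (f̅ c ≡ just b)
    wt-two : ∀ b c → e̅ b ≡ just c → ε̅ b ≡ 2 → wt c ≡ wt b ⊕ unit zero
    wt-one : ∀ b c → e̅ b ≡ just c → ε̅ b ≡ 1 → wt b ≡ wt c ⊕ unit (suc zero)

record QCrystal (k : ℕ) : Set₁ where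
  field
    Carrier : Set
    wt : Carrier → Wt k
    e f : Fin (suc k) → Carrier → Maybe Carrier
    e̅ f̅ : Carrier → Maybe Carrier
    isQ : IsQCrystal wt e f e̅ f̅
  open IsQCrystal isQ public

gl : ∀ {k} → QCrystal k → GlCrystal k
gl Q = record { Carrier = Carrier ; wt = wt ; e = e ; f = f ; isGl = isGl }
  where open QCrystal Q

module _ {k : ℕ} (B C : GlCrystal k) where
  private
    module B = GlCrystal B
    module C = GlCrystal C

  wt⊗ : B.Carrier × C.Carrier → Wt k
  wt⊗ (b , c) = B.wt b ⊕ C.wt c

  e⊗ : Fin (suc k) → B.Carrier × C.Carrier → Maybe (B.Carrier × C.Carrier)
  e⊗ i (b , c) = if B.ε i b ≤ᵇ C.φ i c
                 then map (b ,_) (C.e i c)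
                 else map (_, c) (B.e i b)

  f⊗ : Fin (suc k) → B.Carrier × C.Carrier → Maybe (B.Carrier × C.Carrier)
  f⊗ i (b , c) = if B.ε i b <ᵇ C.φ i c
                 then map (b ,_) (C.f i c)
                 else map (_, c) (B.f i b)

module _ {k : ℕ} (B C : QCrystal k) where
  private
    module B = QCrystal B
    module C = QCrystal C

  e̅⊗ : B.Carrier × C.Carrier → Maybe (B.Carrier × C.Carrier)
  e̅⊗ (b , c) = if (wt₁ (B.wt b) ≡ᵇ 0) ∧ (wt₂ (B.wt b) ≡ᵇ 0)
               then map (b ,_) (C.e̅ c)
               else map (_, c) (B.e̅ b)

  f̅⊗ : B.Carrier × C.Carrier → Maybe (B.Carrier × C.Carrier)
  f̅⊗ (b , c) = if (wt₁ (B.wt b) ≡ᵇ 0) ∧ (wt₂ (B.wt b) ≡ᵇ 0)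
               then map (b ,_) (C.f̅ c)
               else map (_, c) (B.f̅ b)

GlTensorLaw : ℕ → Set₁
GlTensorLaw k = (B C : GlCrystal k) → IsGlCrystal (wt⊗ B C) (e⊗ B C) (f⊗ B C)

QTensorLaw : ℕ → Set₁
QTensorLaw k = (B C : QCrystal k) →
  IsQCrystal (wt⊗ (gl B) (gl C)) (e⊗ (gl B) (gl C)) (f⊗ (gl B) (gl C)) (e̅⊗ B C) (f̅⊗ B C)

tensorGl : ∀ {k} → GlTensorLaw k → GlCrystal k → GlCrystal k → GlCrystal k
tensorGl law B C = record
  { Carrier = GlCrystal.Carrier B × GlCrystal.Carrier C
  ; wt = wt⊗ B C ; e = e⊗ B C ; f = f⊗ B C ; isGl = law B C }

tensorQ : ∀ {k} → QTensorLaw k → QCrystal k → QCrystal k → QCrystal k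
tensorQ law B C = record
  { Carrier = QCrystal.Carrier B × QCrystal.Carrier C
  ; wt = wt⊗ (gl B) (gl C) ; e = e⊗ (gl B) (gl C) ; f = f⊗ (gl B) (gl C)
  ; e̅ = e̅⊗ B C ; f̅ = f̅⊗ B C ; isQ = law B C }

record IsGlIso {k : ℕ} (B C : GlCrystal k)
               (h : GlCrystal.Carrier B → GlCrystal.Carrier C) : Set where
  private
    module B = GlCrystal B
    module C = GlCrystal C
  field
    bijective : Bijective _≡_ _≡_ h
    wt-pres : ∀ b → C.wt (h b) ≡ B.wt b
    e-comm : ∀ i b → C.e i (h b) ≡ map h (B.e i b)
    f-comm : ∀ i b → C.f i (h b) ≡ map h (B.f i b)

record IsQIso {k : ℕ} (B C : QCrystal k)
              (h : QCrystal.Carrier B → QCrystal.Carrier C) : Set where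
  private
    module B = QCrystal B
    module C = QCrystal C
  field
    isGlIso : IsGlIso (gl B) (gl C) h
    e̅-comm : ∀ b → C.e̅ (h b) ≡ map h (B.e̅ b)
    f̅-comm : ∀ b → C.f̅ (h b) ≡ map h (B.f̅ b)

assoc : {B C D : Set} → B × (C × D) → (B × C) × D
assoc (b , (c , d)) = ((b , c) , d)

{-# OPTIONS --safe #-}
module Submission where

-- For a fixed index i, a √gl_n-crystal is a seminormal string structure: e and f are mutually
-- inverse partial maps, and ε, φ count how often each of them can be iterated. The tensor rule
-- makes B ⊗ C seminormal again, with ε(b ⊗ c) = ε(c) + (ε(b) ∸ φ(c)) and
-- φ(b ⊗ c) = φ(b) + (φ(c) ∸ ε(b)): each drops by exactly one along every step of its operator,
-- which characterises the suprema. Then φ − ε is additive, and ε(b ⊗ c) has the parity of ε of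
-- the factor acted on, so the weight axioms are inherited from that factor.
-- The operators e̅, f̅ act on the first factor unless its weight vanishes in positions 1 and 2.
-- They never produce such an element, and e_i, f_i (i ≥ 3) never change those positions, so
-- around any point both e̅ and e_i act through fixed factorwise operators, which commute.
-- For associativity, a three-way case split decides which factor e acts on; f follows because
-- it is the partial inverse of e.

open import Defs
open import Data.Bool using (Bool; true; false; if_then_else_; _∧_)
open import Data.Fin using (Fin; zero; suc; inject₁; toℕ)
open import Data.Fin.Properties using (toℕ-inject₁)
open import Data.Integer as ℤ using (+_)
import Data.Integer.Properties as ℤ
open import Data.Integer.Tactic.RingSolver using (solve-∀)
open import Data.Maybe using (Maybe; just; nothing; map; _>>=_)
open import Data.Maybe.Properties using (map-injective)
open import Data.Nat using (ℕ; zero; suc; _+_; _*_; _∸_; _≤_; _<_; z≤n; s≤s; s≤s⁻¹; _≤ᵇ_; _<ᵇ_; _≡ᵇ_)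
open import Data.Nat.Base using (parity; >-nonZero)
open import Data.Nat.Properties
open import Data.Parity.Base as ℙ using (0ℙ; 1ℙ)
import Data.Parity.Properties as ℙ
open import Data.Product using (Σ-syntax; ∃-syntax; _×_; _,_; proj₁; proj₂; uncurry)
open import Data.Product.Properties using (×-≡,≡←≡)
open import Data.Sum using (_⊎_; inj₁; inj₂)
open import Data.Vec using (lookup)
open import Data.Vec.Properties using (lookup-zipWith; zipWith-assoc; zipWith-comm)
open import Function using (_⇔_; mk⇔; Equivalence; Bijective; _∘_)
open import Relation.Binary.PropositionalEquality
open import Relation.Nullary using (¬_; contradiction; yes; no; Dec; _because_)
open import Relation.Nullary.Reflects
  using (Reflects; ofʸ; ofⁿ; T-reflects; _×-reflects_; fromEquivalence; det)
open Equivalence using (to; from)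

record IsHeight {B : Set} (g : B → Maybe B) (μ : B → ℕ) : Set where
  field
    step : ∀ {x y} → g x ≡ just y → μ x ≡ suc (μ y)
    stop : ∀ {x} → g x ≡ nothing → μ x ≡ 0

module _ {B : Set} {g : B → Maybe B} where

  iter-suc : ∀ j x → iter g (suc j) x ≡ (g x >>= iter g j)
  iter-suc zero x with g x
  ... | just _  = refl
  ... | nothing = refl
  iter-suc (suc j) x rewrite iter-suc j x with g x
  ... | just _  = refl
  ... | nothing = refl

  IsSup-zero : ∀ {x} → g x ≡ nothing → IsSup g x 0
  IsSup-zero gx zero = mk⇔ (λ _ ()) (λ _ → z≤n)
  IsSup-zero {x} gx (suc j) = mk⇔ (λ ()) (λ defined → contradiction stuck defined)
    where
    stuck : iter g (suc j) x ≡ nothing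
    stuck = trans (iter-suc j x) (cong (_>>= iter g j) gx)

  IsSup-suc : ∀ {x y m} → g x ≡ just y → IsSup g y m → IsSup g x (suc m)
  IsSup-suc gx sup zero = mk⇔ (λ _ ()) (λ _ → z≤n)
  IsSup-suc {x} gx sup (suc j) rewrite iter-suc j x | gx =
    mk⇔ (λ j<m → to (sup j) (s≤s⁻¹ j<m)) (λ defined → s≤s (from (sup j) defined))

  IsSup-unique : ∀ {x m n} → IsSup g x m → IsSup g x n → m ≡ n
  IsSup-unique {m = m} {n} supₘ supₙ =
    ≤-antisym (from (supₙ m) (to (supₘ m) ≤-refl)) (from (supₘ n) (to (supₙ n) ≤-refl))

  height⇒IsSup : ∀ {μ} → IsHeight g μ → ∀ x → IsSup g x (μ x)
  height⇒IsSup {μ} height x = go (μ x) x refl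
    where
    open IsHeight height
    go : ∀ m x → μ x ≡ m → IsSup g x m
    go m x μx with g x in gx
    ... | nothing = subst (IsSup g x) (trans (sym (stop gx)) μx) (IsSup-zero gx)
    go zero    x μx | just y = contradiction (trans (sym (step gx)) μx) λ ()
    go (suc m) x μx | just y = IsSup-suc gx (go m y (suc-injective (trans (sym (step gx)) μx)))

  IsSup⇒height : ∀ {μ} → (∀ x → IsSup g x (μ x)) → IsHeight g μ
  IsSup⇒height sup = record
    { step = λ {x} {y} gx → IsSup-unique (sup x) (IsSup-suc gx (sup y))
    ; stop = λ {x} gx → IsSup-unique (sup x) (IsSup-zero gx)
    }

even-or-odd : ∀ m → Even m ⊎ Odd m
even-or-odd zero = inj₁ (0 , refl)
even-or-odd (suc m) with even-or-odd m
... | inj₁ (t , m≡2t)   = inj₂ (t , cong suc m≡2t)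
... | inj₂ (t , m≡1+2t) = inj₁ (suc t , trans (cong suc m≡1+2t) (sym (*-suc 2 t)))

parity-even : ∀ {m} → Even m → parity m ≡ 0ℙ
parity-even (t , refl) = ℙ.*-homo-* 2 t

parity-odd : ∀ {m} → Odd m → parity m ≡ 1ℙ
parity-odd (t , refl) = trans (ℙ.+-homo-+ 1 (2 * t)) (cong (1ℙ ℙ.+_) (ℙ.*-homo-* 2 t))

Even-respects-parity : ∀ {m n} → parity m ≡ parity n → Even m → Even n
Even-respects-parity {n = n} m≡n even with even-or-odd n
... | inj₁ evenₙ = evenₙ
... | inj₂ oddₙ  = contradiction (trans (sym (parity-even even)) (trans m≡n (parity-odd oddₙ))) λ ()

Odd-respects-parity : ∀ {m n} → parity m ≡ parity n → Odd m → Odd n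
Odd-respects-parity {n = n} m≡n odd with even-or-odd n
... | inj₂ oddₙ  = oddₙ
... | inj₁ evenₙ = contradiction (trans (sym (parity-odd odd)) (trans m≡n (parity-even evenₙ))) λ ()

Even-sum⇒parity≡ : ∀ m n → Even (m + n) → parity m ≡ parity n
Even-sum⇒parity≡ m n even = ℙ.+-cancelʳ-≡ (parity n) (parity m) (parity n) (begin
  parity m ℙ.+ parity n  ≡⟨ ℙ.+-homo-+ m n ⟨
  parity (m + n)         ≡⟨ parity-even even ⟩
  0ℙ                     ≡⟨ ℙ.p+p≡0ℙ (parity n) ⟨
  parity n ℙ.+ parity n ∎)
  where open ≡-Reasoning

parity-+∸ : ∀ x {y m} → parity x ≡ parity y → y ≤ m → parity (x + (m ∸ y)) ≡ parity m
parity-+∸ x {y} {m} x≡y y≤m = begin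
  parity (x + (m ∸ y))         ≡⟨ ℙ.+-homo-+ x (m ∸ y) ⟩
  parity x ℙ.+ parity (m ∸ y)  ≡⟨ cong (ℙ._+ parity (m ∸ y)) x≡y ⟩
  parity y ℙ.+ parity (m ∸ y)  ≡⟨ ℙ.+-homo-+ y (m ∸ y) ⟨
  parity (y + (m ∸ y))         ≡⟨ cong parity (m+[n∸m]≡n y≤m) ⟩
  parity m ∎
  where open ≡-Reasoning

[m∸n]-[n∸m]≡m-n : ∀ m n → + (m ∸ n) ℤ.- + (n ∸ m) ≡ + m ℤ.- + n
[m∸n]-[n∸m]≡m-n zero    zero    = refl
[m∸n]-[n∸m]≡m-n zero    (suc n) = refl
[m∸n]-[n∸m]≡m-n (suc m) zero    = refl
[m∸n]-[n∸m]≡m-n (suc m) (suc n) = trans ([m∸n]-[n∸m]≡m-n m n) (shift (+ m) (+ n))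
  where
  shift : ∀ a b → a ℤ.- b ≡ (ℤ.+ 1 ℤ.+ a) ℤ.- (ℤ.+ 1 ℤ.+ b)
  shift = solve-∀

Even-sum-from-difference : ∀ ε φ {z} → + φ ℤ.- + ε ≡ + 2 ℤ.* z → Even (ε + φ)
Even-sum-from-difference ε φ {z} diff = ℤ.∣ + ε ℤ.+ z ∣ , (begin
  ε + φ                          ≡⟨⟩
  ℤ.∣ + (ε + φ) ∣                ≡⟨ cong ℤ.∣_∣ (ℤ.pos-+ ε φ) ⟩
  ℤ.∣ + ε ℤ.+ + φ ∣              ≡⟨ cong ℤ.∣_∣ (regroup (+ ε) (+ φ)) ⟩
  ℤ.∣ + 2 ℤ.* + ε ℤ.+ (+ φ ℤ.- + ε) ∣ ≡⟨ cong (λ d → ℤ.∣ + 2 ℤ.* + ε ℤ.+ d ∣) diff ⟩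
  ℤ.∣ + 2 ℤ.* + ε ℤ.+ + 2 ℤ.* z ∣ ≡⟨ cong ℤ.∣_∣ (ℤ.*-distribˡ-+ (+ 2) (+ ε) z) ⟨
  ℤ.∣ + 2 ℤ.* (+ ε ℤ.+ z) ∣      ≡⟨ ℤ.abs-* (+ 2) (+ ε ℤ.+ z) ⟩
  2 * ℤ.∣ + ε ℤ.+ z ∣ ∎)
  where
  open ≡-Reasoning
  regroup : ∀ a b → a ℤ.+ b ≡ + 2 ℤ.* a ℤ.+ (b ℤ.- a)
  regroup = solve-∀

m+[n∸o]≤p⇒n≤o+[p∸m] : ∀ m n o p → m + (n ∸ o) ≤ p → n ≤ o + (p ∸ m)
m+[n∸o]≤p⇒n≤o+[p∸m] m n o p le = begin
  n            ≤⟨ m≤n+m∸n n o ⟩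
  o + (n ∸ o)  ≤⟨ +-monoʳ-≤ o (m+n≤o⇒m≤o∸n (n ∸ o) (subst (_≤ p) (+-comm m (n ∸ o)) le)) ⟩
  o + (p ∸ m) ∎
  where open ≤-Reasoning

n≤o⇒p<m+[n∸o]⇒p<m : ∀ {m n o p} → n ≤ o → p < m + (n ∸ o) → p < m
n≤o⇒p<m+[n∸o]⇒p<m {m} n≤o = subst (_ <_) (trans (cong (λ k → m + k) (m≤n⇒m∸n≡0 n≤o)) (+-identityʳ m))

o<n⇒p<m+[n∸o]⇒o+[p∸m]<n : ∀ {m n o p} → o < n → p < m + (n ∸ o) → o + (p ∸ m) < n
o<n⇒p<m+[n∸o]⇒o+[p∸m]<n {m} {n} {o} {p} o<n lt = begin-strict
  o + (p ∸ m)  <⟨ +-monoʳ-< o (m<n+o⇒m∸n<o p m {{>-nonZero (m<n⇒0<n∸m o<n)}} lt) ⟩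
  o + (n ∸ o)  ≡⟨ m+[n∸m]≡n (<⇒≤ o<n) ⟩
  n ∎
  where open ≤-Reasoning

∸-vanish-step : ∀ x {m n} → m ≤ n → suc x + (m ∸ n) ≡ suc (x + (m ∸ suc n))
∸-vanish-step x m≤n rewrite m≤n⇒m∸n≡0 m≤n | m≤n⇒m∸n≡0 (m≤n⇒m≤1+n m≤n) = refl

∸-suc-step : ∀ x {m n} → n ≤ m → x + (suc m ∸ n) ≡ suc (x + (m ∸ n))
∸-suc-step x n≤m rewrite +-∸-assoc 1 n≤m = +-suc x _

Commute : {X : Set} → (X → Maybe X) → (X → Maybe X) → Set
Commute G H = ∀ x → (G x >>= H) ≡ (H x >>= G)

bind-cong : {X Y : Set} {k k′ : X → Maybe Y} (m : Maybe X) →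
            (∀ x → m ≡ just x → k x ≡ k′ x) → (m >>= k) ≡ (m >>= k′)
bind-cong nothing  _     = refl
bind-cong (just x) k≡k′ = k≡k′ x refl

commute-at : {X : Set} {G H G₀ H₀ : X → Maybe X} (x : X) → Commute G₀ H₀ →
             G x ≡ G₀ x → H x ≡ H₀ x →
             (∀ y → G x ≡ just y → H y ≡ H₀ y) → (∀ y → H x ≡ just y → G y ≡ G₀ y) →
             (G x >>= H) ≡ (H x >>= G)
commute-at {G = G} {H} {G₀} {H₀} x comm G≡ H≡ H≡-after-G G≡-after-H = begin
  (G x >>= H)    ≡⟨ bind-cong (G x) H≡-after-G ⟩
  (G x >>= H₀)   ≡⟨ cong (_>>= H₀) G≡ ⟩
  (G₀ x >>= H₀)  ≡⟨ comm x ⟩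
  (H₀ x >>= G₀)  ≡⟨ cong (_>>= G₀) H≡ ⟨
  (H x >>= G₀)   ≡⟨ bind-cong (H x) G≡-after-H ⟨
  (H x >>= G) ∎
  where open ≡-Reasoning

module _ {B C : Set} where

  left : (B → Maybe B) → B × C → Maybe (B × C)
  left g (b , c) = map (_, c) (g b)

  right : (C → Maybe C) → B × C → Maybe (B × C)
  right h (b , c) = map (b ,_) (h c)

  branch : Bool → (B → Maybe B) → (C → Maybe C) → B × C → Maybe (B × C)
  branch t g h = if t then right h else left g

  -- e⊗, f⊗, e̅⊗ and f̅⊗ are definitionally of this form
  choose : (B → C → Bool) → (B → Maybe B) → (C → Maybe C) → B × C → Maybe (B × C)
  choose κ g h (b , c) = if κ b c then right h (b , c) else left g (b , c)

  left-bind : (g g′ : B → Maybe B) (b : B) (c : C) →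
              (left g (b , c) >>= left g′) ≡ map (_, c) (g b >>= g′)
  left-bind g g′ b c with g b
  ... | just _  = refl
  ... | nothing = refl

  right-bind : (h h′ : C → Maybe C) (b : B) (c : C) →
               (right h (b , c) >>= right h′) ≡ map (b ,_) (h c >>= h′)
  right-bind h h′ b c with h c
  ... | just _  = refl
  ... | nothing = refl

  left-comm : (g g′ : B → Maybe B) → Commute g g′ → Commute (left g) (left g′)
  left-comm g g′ comm (b , c) =
    trans (left-bind g g′ b c) (trans (cong (map (_, c)) (comm b)) (sym (left-bind g′ g b c)))

  right-comm : (h h′ : C → Maybe C) → Commute h h′ → Commute (right h) (right h′)
  right-comm h h′ comm (b , c) =
    trans (right-bind h h′ b c) (trans (cong (map (b ,_)) (comm c)) (sym (right-bind h′ h b c)))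

  left-right-comm : (g : B → Maybe B) (h : C → Maybe C) → Commute (left g) (right h)
  left-right-comm g h (b , c) with g b in gb | h c in hc
  ... | just _  | just _  rewrite gb | hc = refl
  ... | just _  | nothing rewrite hc      = refl
  ... | nothing | just _  rewrite gb      = refl
  ... | nothing | nothing                 = refl

  branch-comm : (g g′ : B → Maybe B) (h h′ : C → Maybe C) → Commute g g′ → Commute h h′ →
                ∀ s t → Commute (branch s g h) (branch t g′ h′)
  branch-comm g g′ h h′ _     commₕ true  true  = right-comm h h′ commₕ
  branch-comm g g′ h h′ _     _     true  false = λ p → sym (left-right-comm g′ h p)
  branch-comm g g′ h h′ _     _     false true  = left-right-comm g h′
  branch-comm g g′ h h′ commₗ _     false false = left-comm g g′ commₗ

module Choose {B C : Set} (κ : B → C → Bool) (g : B → Maybe B) (h : C → Maybe C) where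

  as-branch : ∀ {p t} → uncurry κ p ≡ t → choose κ g h p ≡ branch t g h p
  as-branch {b , c} refl with κ b c
  ... | true  = refl
  ... | false = refl

  module _ {A : Set} {b : B} {c : C} where

    at-right : Reflects A (κ b c) → A → choose κ g h (b , c) ≡ map (b ,_) (h c)
    at-right r a with κ b c | r
    ... | true  | _       = refl
    ... | false | ofⁿ ¬a = contradiction a ¬a

    at-left : Reflects A (κ b c) → ¬ A → choose κ g h (b , c) ≡ map (_, c) (g b)
    at-left r ¬a with κ b c | r
    ... | true  | ofʸ a = contradiction a ¬a
    ... | false | _     = refl

    just-cases : ∀ {q} → Reflects A (κ b c) → choose κ g h (b , c) ≡ just q →
                 (A × ∃[ c′ ] (h c ≡ just c′ × q ≡ (b , c′))) ⊎
                 (¬ A × ∃[ b′ ] (g b ≡ just b′ × q ≡ (b′ , c)))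
    just-cases r eq with κ b c | r
    just-cases r eq | true | ofʸ a with h c | eq
    ... | just c′ | refl = inj₁ (a , c′ , refl , refl)
    just-cases r eq | false | ofⁿ ¬a with g b | eq
    ... | just b′ | refl = inj₂ (¬a , b′ , refl , refl)

    nothing-cases : Reflects A (κ b c) → choose κ g h (b , c) ≡ nothing →
                    (A × h c ≡ nothing) ⊎ (¬ A × g b ≡ nothing)
    nothing-cases r eq with κ b c | r
    nothing-cases r eq | true | ofʸ a with h c | eq
    ... | nothing | _ = inj₁ (a , refl)
    nothing-cases r eq | false | ofⁿ ¬a with g b | eq
    ... | nothing | _ = inj₂ (¬a , refl)

  preserves : {X : Set} (P : B × C → X) →
              (∀ {b b′} c → g b ≡ just b′ → P (b′ , c) ≡ P (b , c)) →
              (∀ b {c c′} → h c ≡ just c′ → P (b , c′) ≡ P (b , c)) →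
              ∀ {p q} → choose κ g h p ≡ just q → P q ≡ P p
  preserves P along-g along-h {b , c} eq with just-cases (T-reflects (κ b c)) eq
  ... | inj₁ (_ , _ , hc , refl) = along-h b hc
  ... | inj₂ (_ , _ , gb , refl) = along-g c gb

choose-comm : {B C : Set} {κ ζ : B → C → Bool} {g g′ : B → Maybe B} {h h′ : C → Maybe C} →
              Commute g g′ → Commute h h′ →
              (∀ {p q} → choose κ g h p ≡ just q → uncurry ζ q ≡ uncurry ζ p) →
              (∀ {p q} → choose ζ g′ h′ p ≡ just q → uncurry κ q ≡ uncurry κ p) →
              Commute (choose κ g h) (choose ζ g′ h′)
choose-comm {κ = κ} {ζ} {g} {g′} {h} {h′} commₗ commₕ keeps-ζ keeps-κ p =
  commute-at p (branch-comm g g′ h h′ commₗ commₕ (uncurry κ p) (uncurry ζ p))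
    (G.as-branch refl) (H.as-branch refl)
    (λ _ eq → H.as-branch (keeps-ζ eq)) (λ _ eq → G.as-branch (keeps-κ eq))
  where
  module G = Choose κ g h
  module H = Choose ζ g′ h′

-- Seminormal strings and their tensor product

record Seminormal (B : Set) : Set where
  field
    e f   : B → Maybe B
    ε φ   : B → ℕ
    ε-sup : ∀ b → IsSup e b (ε b)
    φ-sup : ∀ b → IsSup f b (φ b)
    e⇔f   : ∀ b c → (e b ≡ just c) ⇔ (f c ≡ just b)

  open IsHeight (IsSup⇒height ε-sup) public renaming (step to ε-step; stop to ε-stop)
  open IsHeight (IsSup⇒height φ-sup) public renaming (step to φ-step; stop to φ-stop)

  φ-after-e : ∀ {b b′} → e b ≡ just b′ → φ b′ ≡ suc (φ b)
  φ-after-e {b} {b′} eb = φ-step (to (e⇔f b b′) eb)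

  ε-after-f : ∀ {b b′} → f b ≡ just b′ → ε b′ ≡ suc (ε b)
  ε-after-f {b} {b′} fb = ε-step (from (e⇔f b′ b) fb)

module Tensor {B C : Set} (S : Seminormal B) (T : Seminormal C) where
  private
    module S = Seminormal S
    module T = Seminormal T
    open ≡-Reasoning

  e f : B × C → Maybe (B × C)
  e = choose (λ b c → S.ε b ≤ᵇ T.φ c) S.e T.e
  f = choose (λ b c → S.ε b <ᵇ T.φ c) S.f T.f

  ε φ : B × C → ℕ
  ε (b , c) = T.ε c + (S.ε b ∸ T.φ c)
  φ (b , c) = S.φ b + (T.φ c ∸ S.ε b)

  module E = Choose (λ b c → S.ε b ≤ᵇ T.φ c) S.e T.e
  module F = Choose (λ b c → S.ε b <ᵇ T.φ c) S.f T.f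

  module _ {b : B} {c : C} where

    ≤-reflects : Reflects (S.ε b ≤ T.φ c) (S.ε b ≤ᵇ T.φ c)
    ≤-reflects = ≤ᵇ-reflects-≤ (S.ε b) (T.φ c)

    <-reflects : Reflects (S.ε b < T.φ c) (S.ε b <ᵇ T.φ c)
    <-reflects = <ᵇ-reflects-< (S.ε b) (T.φ c)

    e-right : S.ε b ≤ T.φ c → e (b , c) ≡ map (b ,_) (T.e c)
    e-right = E.at-right ≤-reflects

    e-left : T.φ c < S.ε b → e (b , c) ≡ map (_, c) (S.e b)
    e-left φ<ε = E.at-left ≤-reflects (<⇒≱ φ<ε)

    f-right : S.ε b < T.φ c → f (b , c) ≡ map (b ,_) (T.f c)
    f-right = F.at-right <-reflects

    f-left : T.φ c ≤ S.ε b → f (b , c) ≡ map (_, c) (S.f b)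
    f-left φ≤ε = F.at-left <-reflects (≤⇒≯ φ≤ε)

    e-just : ∀ {q} → e (b , c) ≡ just q →
             (S.ε b ≤ T.φ c × ∃[ c′ ] (T.e c ≡ just c′ × q ≡ (b , c′))) ⊎
             (¬ S.ε b ≤ T.φ c × ∃[ b′ ] (S.e b ≡ just b′ × q ≡ (b′ , c)))
    e-just = E.just-cases ≤-reflects

    f-just : ∀ {q} → f (b , c) ≡ just q →
             (S.ε b < T.φ c × ∃[ c′ ] (T.f c ≡ just c′ × q ≡ (b , c′))) ⊎
             (¬ S.ε b < T.φ c × ∃[ b′ ] (S.f b ≡ just b′ × q ≡ (b′ , c)))
    f-just = F.just-cases <-reflects

    e-nothing : e (b , c) ≡ nothing →
                (S.ε b ≤ T.φ c × T.e c ≡ nothing) ⊎ (¬ S.ε b ≤ T.φ c × S.e b ≡ nothing)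
    e-nothing = E.nothing-cases ≤-reflects

    f-nothing : f (b , c) ≡ nothing →
                (S.ε b < T.φ c × T.f c ≡ nothing) ⊎ (¬ S.ε b < T.φ c × S.f b ≡ nothing)
    f-nothing = F.nothing-cases <-reflects

    φ≤ε-after-e : ∀ {b′} → ¬ S.ε b ≤ T.φ c → S.e b ≡ just b′ → T.φ c ≤ S.ε b′
    φ≤ε-after-e ε≰φ eb = s≤s⁻¹ (subst (T.φ c <_) (S.ε-step eb) (≰⇒> ε≰φ))

    ε≤φ-after-f : ∀ {c′} → S.ε b < T.φ c → T.f c ≡ just c′ → S.ε b ≤ T.φ c′
    ε≤φ-after-f ε<φ fc = s≤s⁻¹ (subst (S.ε b <_) (T.φ-step fc) ε<φ)

  ε-height : IsHeight e ε
  ε-height = record { step = step ; stop = stop }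
    where
    step : ∀ {p q} → e p ≡ just q → ε p ≡ suc (ε q)
    step {b , c} eq with e-just eq
    ... | inj₁ (ε≤φ , c′ , ec , refl) rewrite T.ε-step ec | T.φ-after-e ec =
      ∸-vanish-step (T.ε c′) ε≤φ
    ... | inj₂ (ε≰φ , b′ , eb , refl) = begin
      T.ε c + (S.ε b ∸ T.φ c)         ≡⟨ cong (λ n → T.ε c + (n ∸ T.φ c)) (S.ε-step eb) ⟩
      T.ε c + (suc (S.ε b′) ∸ T.φ c)  ≡⟨ ∸-suc-step (T.ε c) (φ≤ε-after-e ε≰φ eb) ⟩
      suc (T.ε c + (S.ε b′ ∸ T.φ c)) ∎
    stop : ∀ {p} → e p ≡ nothing → ε p ≡ 0
    stop {b , c} eq with e-nothing eq
    ... | inj₁ (ε≤φ , ec) = cong₂ _+_ (T.ε-stop ec) (m≤n⇒m∸n≡0 ε≤φ)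
    ... | inj₂ (ε≰φ , eb) = contradiction (subst (_≤ T.φ c) (sym (S.ε-stop eb)) z≤n) ε≰φ

  φ-height : IsHeight f φ
  φ-height = record { step = step ; stop = stop }
    where
    step : ∀ {p q} → f p ≡ just q → φ p ≡ suc (φ q)
    step {b , c} eq with f-just eq
    ... | inj₁ (ε<φ , c′ , fc , refl) = begin
      S.φ b + (T.φ c ∸ S.ε b)         ≡⟨ cong (λ n → S.φ b + (n ∸ S.ε b)) (T.φ-step fc) ⟩
      S.φ b + (suc (T.φ c′) ∸ S.ε b)  ≡⟨ ∸-suc-step (S.φ b) (ε≤φ-after-f ε<φ fc) ⟩
      suc (S.φ b + (T.φ c′ ∸ S.ε b)) ∎
    ... | inj₂ (ε≮φ , b′ , fb , refl) rewrite S.φ-step fb | S.ε-after-f fb =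
      ∸-vanish-step (S.φ b′) (≮⇒≥ ε≮φ)
    stop : ∀ {p} → f p ≡ nothing → φ p ≡ 0
    stop {b , c} eq with f-nothing eq
    ... | inj₁ (ε<φ , fc) = contradiction (subst (S.ε b <_) (T.φ-stop fc) ε<φ) λ ()
    ... | inj₂ (ε≮φ , fb) = cong₂ _+_ (S.φ-stop fb) (m≤n⇒m∸n≡0 (≮⇒≥ ε≮φ))

  e⇒f : ∀ {p q} → e p ≡ just q → f q ≡ just p
  e⇒f {b , c} eq with e-just eq
  ... | inj₁ (ε≤φ , c′ , ec , refl) =
    trans (f-right (subst (S.ε b <_) (sym (T.φ-after-e ec)) (s≤s ε≤φ)))
          (cong (map (b ,_)) (to (T.e⇔f c c′) ec))
  ... | inj₂ (ε≰φ , b′ , eb , refl) =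
    trans (f-left (φ≤ε-after-e ε≰φ eb)) (cong (map (_, c)) (to (S.e⇔f b b′) eb))

  f⇒e : ∀ {p q} → f q ≡ just p → e p ≡ just q
  f⇒e {q = b , c} eq with f-just eq
  ... | inj₁ (ε<φ , c′ , fc , refl) =
    trans (e-right (ε≤φ-after-f ε<φ fc)) (cong (map (b ,_)) (from (T.e⇔f c′ c) fc))
  ... | inj₂ (ε≮φ , b′ , fb , refl) =
    trans (e-left (subst (T.φ c <_) (sym (S.ε-after-f fb)) (s≤s (≮⇒≥ ε≮φ))))
          (cong (map (_, c)) (from (S.e⇔f b′ b) fb))

  φ-ε : ∀ b c → + φ (b , c) ℤ.- + ε (b , c) ≡ (+ S.φ b ℤ.- + S.ε b) ℤ.+ (+ T.φ c ℤ.- + T.ε c)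
  φ-ε b c = begin
    + (S.φ b + (T.φ c ∸ S.ε b)) ℤ.- + (T.ε c + (S.ε b ∸ T.φ c))
      ≡⟨ cong₂ ℤ._-_ (ℤ.pos-+ (S.φ b) (T.φ c ∸ S.ε b)) (ℤ.pos-+ (T.ε c) (S.ε b ∸ T.φ c)) ⟩
    (+ S.φ b ℤ.+ + (T.φ c ∸ S.ε b)) ℤ.- (+ T.ε c ℤ.+ + (S.ε b ∸ T.φ c))
      ≡⟨ regroup (+ S.φ b) (+ (T.φ c ∸ S.ε b)) (+ T.ε c) (+ (S.ε b ∸ T.φ c)) ⟩
    (+ S.φ b ℤ.- + T.ε c) ℤ.+ (+ (T.φ c ∸ S.ε b) ℤ.- + (S.ε b ∸ T.φ c))
      ≡⟨ cong (λ d → (+ S.φ b ℤ.- + T.ε c) ℤ.+ d) ([m∸n]-[n∸m]≡m-n (T.φ c) (S.ε b)) ⟩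
    (+ S.φ b ℤ.- + T.ε c) ℤ.+ (+ T.φ c ℤ.- + S.ε b)
      ≡⟨ exchange (+ S.φ b) (+ T.ε c) (+ T.φ c) (+ S.ε b) ⟩
    (+ S.φ b ℤ.- + S.ε b) ℤ.+ (+ T.φ c ℤ.- + T.ε c) ∎
    where
    regroup : ∀ w x y z → (w ℤ.+ x) ℤ.- (y ℤ.+ z) ≡ (w ℤ.- y) ℤ.+ (x ℤ.- z)
    regroup = solve-∀
    exchange : ∀ w x y z → (w ℤ.- x) ℤ.+ (y ℤ.- z) ≡ (w ℤ.- z) ℤ.+ (y ℤ.- x)
    exchange = solve-∀

  e-just-parity : ∀ {b c q} → parity (T.ε c) ≡ parity (T.φ c) → e (b , c) ≡ just q →
                  (∃[ c′ ] (T.e c ≡ just c′ × q ≡ (b , c′) × parity (ε (b , c)) ≡ parity (T.ε c))) ⊎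
                  (∃[ b′ ] (S.e b ≡ just b′ × q ≡ (b′ , c) × parity (ε (b , c)) ≡ parity (S.ε b)))
  e-just-parity {b} {c} εc≡φc eq with e-just eq
  ... | inj₁ (ε≤φ , c′ , ec , refl) =
    inj₁ (c′ , ec , refl , cong parity (trans (cong (λ n → T.ε c + n) (m≤n⇒m∸n≡0 ε≤φ))
                                              (+-identityʳ (T.ε c))))
  ... | inj₂ (ε≰φ , b′ , eb , refl) =
    inj₂ (b′ , eb , refl , parity-+∸ (T.ε c) εc≡φc (<⇒≤ (≰⇒> ε≰φ)))

_⊗_ : {B C : Set} → Seminormal B → Seminormal C → Seminormal (B × C)
S ⊗ T = record
  { e = e ; f = f ; ε = ε ; φ = φ
  ; ε-sup = height⇒IsSup ε-height
  ; φ-sup = height⇒IsSup φ-height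
  ; e⇔f = λ _ _ → mk⇔ e⇒f f⇒e
  }
  where open Tensor S T

PreservesStrings : {B : Set} → (B → Maybe B) → Seminormal B → Set
PreservesStrings g S = ∀ b b′ → g b ≡ just b′ → (ε b′ ≡ ε b) × (φ b′ ≡ φ b)
  where open Seminormal S

choose-preserves-strings : {B C : Set} {S : Seminormal B} {T : Seminormal C}
                           {κ : B → C → Bool} {g : B → Maybe B} {h : C → Maybe C} →
                           PreservesStrings g S → PreservesStrings h T →
                           PreservesStrings (choose κ g h) (S ⊗ T)
choose-preserves-strings {S = S} {T} {κ} {g} {h} g-preserves h-preserves p q eq =
  ×-≡,≡←≡ (Choose.preserves κ g h (λ p → ε p , φ p) along-g along-h eq)
  where
  open Tensor S T using (ε; φ)
  module S = Seminormal S
  module T = Seminormal T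
  along-g : ∀ {b b′} c → g b ≡ just b′ → (ε (b′ , c) , φ (b′ , c)) ≡ (ε (b , c) , φ (b , c))
  along-g {b} {b′} c gb with g-preserves b b′ gb
  ... | ε≡ , φ≡ = cong₂ (λ x y → T.ε c + (x ∸ T.φ c) , y + (T.φ c ∸ x)) ε≡ φ≡
  along-h : ∀ b {c c′} → h c ≡ just c′ → (ε (b , c′) , φ (b , c′)) ≡ (ε (b , c) , φ (b , c))
  along-h b {c} {c′} hc with h-preserves c c′ hc
  ... | ε≡ , φ≡ = cong₂ (λ x y → x + (S.ε b ∸ y) , S.φ b + (y ∸ S.ε b)) ε≡ φ≡

-- Associativity

Intertwines : {A B : Set} → (A → B) → (A → Maybe A) → (B → Maybe B) → Set
Intertwines h g g′ = ∀ x → g′ (h x) ≡ map h (g x)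

intertwines-partial-inverse :
  {A B : Set} {h : A → B} {e f : A → Maybe A} {e′ f′ : B → Maybe B} → Bijective _≡_ _≡_ h →
  (∀ x y → (e x ≡ just y) ⇔ (f y ≡ just x)) → (∀ x y → (e′ x ≡ just y) ⇔ (f′ y ≡ just x)) →
  Intertwines h e e′ → Intertwines h f f′
intertwines-partial-inverse {h = h} {e} {f} {e′} {f′} (injective , surjective) e⇔f e′⇔f′ e-comm x
  with f x in fx
... | just y = to (e′⇔f′ (h y) (h x)) (trans (e-comm y) (cong (map h) (from (e⇔f y x) fx)))
... | nothing with f′ (h x) in f′hx
...   | nothing = refl
...   | just z with surjective z
...     | y , hy≡z = contradiction (trans (sym fx) (to (e⇔f y x) ey)) λ ()
  where
  ey : e y ≡ just x
  ey = map-injective injective (begin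
    map h (e y)  ≡⟨ e-comm y ⟨
    e′ (h y)     ≡⟨ cong e′ (hy≡z refl) ⟩
    e′ z         ≡⟨ from (e′⇔f′ z (h x)) f′hx ⟩
    just (h x) ∎)
    where open ≡-Reasoning

assoc-bijective : {A B C : Set} → Bijective _≡_ _≡_ (assoc {A} {B} {C})
assoc-bijective =
  (λ { {_ , _ , _} {_ , _ , _} refl → refl }) , (λ { ((a , b) , c) → (a , b , c) , λ { refl → refl } })

module _ {A B C : Set} where

  map-assoc₃ : {a : A} {b : B} (m : Maybe C) → map ((a , b) ,_) m ≡ map assoc (map (a ,_) (map (b ,_) m))
  map-assoc₃ (just _) = refl
  map-assoc₃ nothing  = refl

  map-assoc₂ : {a : A} {c : C} (m : Maybe B) → map (_, c) (map (a ,_) m) ≡ map assoc (map (a ,_) (map (_, c) m))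
  map-assoc₂ (just _) = refl
  map-assoc₂ nothing  = refl

  map-assoc₁ : {b : B} {c : C} (m : Maybe A) → map (_, c) (map (_, b) m) ≡ map assoc (map (_, (b , c)) m)
  map-assoc₁ (just _) = refl
  map-assoc₁ nothing  = refl

module Associativity {B C D : Set} (S : Seminormal B) (T : Seminormal C) (U : Seminormal D) where
  private
    module S = Seminormal S
    module T = Seminormal T
    module U = Seminormal U
    module S⊗T = Tensor S T
    module T⊗U = Tensor T U
    module [S⊗T]⊗U = Tensor (S ⊗ T) U
    module S⊗[T⊗U] = Tensor S (T ⊗ U)
    open ≡-Reasoning

  e-assoc : Intertwines assoc (Seminormal.e (S ⊗ (T ⊗ U))) (Seminormal.e ((S ⊗ T) ⊗ U))
  e-assoc (b , c , d) with T.ε c + (S.ε b ∸ T.φ c) ≤? U.φ d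
  ... | yes εST≤φU = begin
    [S⊗T]⊗U.e ((b , c) , d)
      ≡⟨ [S⊗T]⊗U.e-right εST≤φU ⟩
    map ((b , c) ,_) (U.e d)
      ≡⟨ map-assoc₃ (U.e d) ⟩
    map assoc (map (b ,_) (map (c ,_) (U.e d)))
      ≡⟨ cong (λ m → map assoc (map (b ,_) m)) (T⊗U.e-right εT≤φU) ⟨
    map assoc (map (b ,_) (T⊗U.e (c , d)))
      ≡⟨ cong (map assoc) (S⊗[T⊗U].e-right εS≤φTU) ⟨
    map assoc (S⊗[T⊗U].e (b , c , d)) ∎
    where
    εT≤φU : T.ε c ≤ U.φ d
    εT≤φU = m+n≤o⇒m≤o (T.ε c) εST≤φU
    εS≤φTU : S.ε b ≤ T.φ c + (U.φ d ∸ T.ε c)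
    εS≤φTU = m+[n∸o]≤p⇒n≤o+[p∸m] (T.ε c) (S.ε b) (T.φ c) (U.φ d) εST≤φU
  ... | no εST≰φU with S.ε b ≤? T.φ c
  ...   | yes εS≤φT = begin
    [S⊗T]⊗U.e ((b , c) , d)
      ≡⟨ [S⊗T]⊗U.e-left (≰⇒> εST≰φU) ⟩
    map (_, d) (S⊗T.e (b , c))
      ≡⟨ cong (map (_, d)) (S⊗T.e-right εS≤φT) ⟩
    map (_, d) (map (b ,_) (T.e c))
      ≡⟨ map-assoc₂ (T.e c) ⟩
    map assoc (map (b ,_) (map (_, d) (T.e c)))
      ≡⟨ cong (λ m → map assoc (map (b ,_) m)) (T⊗U.e-left φU<εT) ⟨
    map assoc (map (b ,_) (T⊗U.e (c , d)))
      ≡⟨ cong (map assoc) (S⊗[T⊗U].e-right εS≤φTU) ⟨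
    map assoc (S⊗[T⊗U].e (b , c , d)) ∎
    where
    φU<εT : U.φ d < T.ε c
    φU<εT = n≤o⇒p<m+[n∸o]⇒p<m εS≤φT (≰⇒> εST≰φU)
    εS≤φTU : S.ε b ≤ T.φ c + (U.φ d ∸ T.ε c)
    εS≤φTU = m≤n⇒m≤n+o (U.φ d ∸ T.ε c) εS≤φT
  ...   | no εS≰φT = begin
    [S⊗T]⊗U.e ((b , c) , d)
      ≡⟨ [S⊗T]⊗U.e-left (≰⇒> εST≰φU) ⟩
    map (_, d) (S⊗T.e (b , c))
      ≡⟨ cong (map (_, d)) (S⊗T.e-left (≰⇒> εS≰φT)) ⟩
    map (_, d) (map (_, c) (S.e b))
      ≡⟨ map-assoc₁ (S.e b) ⟩
    map assoc (map (_, (c , d)) (S.e b))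
      ≡⟨ cong (map assoc) (S⊗[T⊗U].e-left φTU<εS) ⟨
    map assoc (S⊗[T⊗U].e (b , c , d)) ∎
    where
    φTU<εS : T.φ c + (U.φ d ∸ T.ε c) < S.ε b
    φTU<εS = o<n⇒p<m+[n∸o]⇒o+[p∸m]<n (≰⇒> εS≰φT) (≰⇒> εST≰φU)

  f-assoc : Intertwines assoc (Seminormal.f (S ⊗ (T ⊗ U))) (Seminormal.f ((S ⊗ T) ⊗ U))
  f-assoc = intertwines-partial-inverse assoc-bijective
    (Seminormal.e⇔f (S ⊗ (T ⊗ U))) (Seminormal.e⇔f ((S ⊗ T) ⊗ U)) e-assoc

module _ {k : ℕ} where

  ⊕-assoc : (u v w : Wt k) → u ⊕ v ⊕ w ≡ u ⊕ (v ⊕ w)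
  ⊕-assoc = zipWith-assoc +-assoc

  ⊕-comm : (u v : Wt k) → u ⊕ v ≡ v ⊕ u
  ⊕-comm = zipWith-comm +-comm

  lookup-⊕ : (u v : Wt k) (j : Fin (suc (suc k))) → lookup (u ⊕ v) j ≡ lookup u j + lookup v j
  lookup-⊕ u v j = lookup-zipWith _+_ j u v

  +lookup-⊕ : (u v : Wt k) (j : Fin (suc (suc k))) → + lookup (u ⊕ v) j ≡ + lookup u j ℤ.+ + lookup v j
  +lookup-⊕ u v j = trans (cong +_ (lookup-⊕ u v j)) (ℤ.pos-+ (lookup u j) (lookup v j))

  ⊕-shiftʳ : ∀ {u v v′ x : Wt k} → v′ ≡ v ⊕ x → u ⊕ v′ ≡ u ⊕ v ⊕ x
  ⊕-shiftʳ {u} {v} {x = x} refl = sym (⊕-assoc u v x)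

  ⊕-shiftˡ : ∀ {u u′ v x : Wt k} → u′ ≡ u ⊕ x → u′ ⊕ v ≡ u ⊕ v ⊕ x
  ⊕-shiftˡ {u} {v = v} {x} refl = begin
    u ⊕ x ⊕ v    ≡⟨ ⊕-assoc u x v ⟩
    u ⊕ (x ⊕ v)  ≡⟨ cong (u ⊕_) (⊕-comm x v) ⟩
    u ⊕ (v ⊕ x)  ≡⟨ ⊕-assoc u v x ⟨
    u ⊕ v ⊕ x ∎
    where open ≡-Reasoning

-- √gl_n-crystals

strings : ∀ {k} (B : GlCrystal k) → Fin (suc k) → Seminormal (GlCrystal.Carrier B)
strings B i = record
  { e = e i ; f = f i ; ε = ε i ; φ = φ i ; ε-sup = ε-sup i ; φ-sup = φ-sup i ; e⇔f = e⇔f i }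
  where open GlCrystal B

module GlTensor {k : ℕ} (B C : GlCrystal k) where
  private
    module B = GlCrystal B
    module C = GlCrystal C
    module B⊗C (i : Fin (suc k)) = Tensor (strings B i) (strings C i)

  half-diff : ∀ i p → + B⊗C.φ i p ℤ.- + B⊗C.ε i p
                      ≡ + 2 ℤ.* (+ wtᵢ (wt⊗ B C p) i ℤ.- + wtᵢ₊₁ (wt⊗ B C p) i)
  half-diff i (b , c) = begin
    + B⊗C.φ i (b , c) ℤ.- + B⊗C.ε i (b , c)
      ≡⟨ B⊗C.φ-ε i b c ⟩
    (+ B.φ i b ℤ.- + B.ε i b) ℤ.+ (+ C.φ i c ℤ.- + C.ε i c)
      ≡⟨ cong₂ ℤ._+_ (B.half-diff i b) (C.half-diff i c) ⟩
    + 2 ℤ.* (+ wtᵢ wb i ℤ.- + wtᵢ₊₁ wb i) ℤ.+ + 2 ℤ.* (+ wtᵢ wc i ℤ.- + wtᵢ₊₁ wc i)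
      ≡⟨ distrib (+ wtᵢ wb i) (+ wtᵢ₊₁ wb i) (+ wtᵢ wc i) (+ wtᵢ₊₁ wc i) ⟩
    + 2 ℤ.* ((+ wtᵢ wb i ℤ.+ + wtᵢ wc i) ℤ.- (+ wtᵢ₊₁ wb i ℤ.+ + wtᵢ₊₁ wc i))
      ≡⟨ cong₂ (λ x y → + 2 ℤ.* (x ℤ.- y)) (+lookup-⊕ wb wc (inject₁ i)) (+lookup-⊕ wb wc (suc i)) ⟨
    + 2 ℤ.* (+ wtᵢ (wb ⊕ wc) i ℤ.- + wtᵢ₊₁ (wb ⊕ wc) i) ∎
    where
    open ≡-Reasoning
    wb wc : Wt k
    wb = B.wt b
    wc = C.wt c
    distrib : ∀ w x y z → + 2 ℤ.* (w ℤ.- x) ℤ.+ + 2 ℤ.* (y ℤ.- z) ≡ + 2 ℤ.* ((w ℤ.+ y) ℤ.- (x ℤ.+ z))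
    distrib = solve-∀

  C-parity : ∀ i c → parity (C.ε i c) ≡ parity (C.φ i c)
  C-parity i c = Even-sum⇒parity≡ (C.ε i c) (C.φ i c) (C.sum-even i c)

  wt-even : ∀ i p q → e⊗ B C i p ≡ just q → Even (B⊗C.ε i p) →
            wt⊗ B C q ≡ wt⊗ B C p ⊕ unit (inject₁ i)
  wt-even i (b , c) q eq even with B⊗C.e-just-parity i (C-parity i c) eq
  ... | inj₁ (c′ , ec , refl , ≡parity) = ⊕-shiftʳ (C.wt-even i c c′ ec (Even-respects-parity ≡parity even))
  ... | inj₂ (b′ , eb , refl , ≡parity) = ⊕-shiftˡ (B.wt-even i b b′ eb (Even-respects-parity ≡parity even))

  wt-odd : ∀ i p q → e⊗ B C i p ≡ just q → Odd (B⊗C.ε i p) →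
           wt⊗ B C p ≡ wt⊗ B C q ⊕ unit (suc i)
  wt-odd i (b , c) q eq odd with B⊗C.e-just-parity i (C-parity i c) eq
  ... | inj₁ (c′ , ec , refl , ≡parity) = ⊕-shiftʳ (C.wt-odd i c c′ ec (Odd-respects-parity ≡parity odd))
  ... | inj₂ (b′ , eb , refl , ≡parity) = ⊕-shiftˡ (B.wt-odd i b b′ eb (Odd-respects-parity ≡parity odd))

  isGlCrystal : IsGlCrystal (wt⊗ B C) (e⊗ B C) (f⊗ B C)
  isGlCrystal = record
    { ε = λ i → Seminormal.ε (strings B i ⊗ strings C i)
    ; φ = λ i → Seminormal.φ (strings B i ⊗ strings C i)
    ; ε-sup = λ i → Seminormal.ε-sup (strings B i ⊗ strings C i)
    ; φ-sup = λ i → Seminormal.φ-sup (strings B i ⊗ strings C i)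
    ; sum-even = λ i p → Even-sum-from-difference (B⊗C.ε i p) (B⊗C.φ i p) (half-diff i p)
    ; half-diff = half-diff
    ; e⇔f = λ i → Seminormal.e⇔f (strings B i ⊗ strings C i)
    ; wt-even = wt-even
    ; wt-odd = wt-odd
    }

glTensor : ∀ {k} → GlTensorLaw k
glTensor = GlTensor.isGlCrystal

glAssoc : ∀ {k} (B C D : GlCrystal k) →
          IsGlIso (tensorGl glTensor B (tensorGl glTensor C D)) (tensorGl glTensor (tensorGl glTensor B C) D) assoc
glAssoc B C D = record
  { bijective = assoc-bijective
  ; wt-pres = λ { (b , c , d) → ⊕-assoc (GlCrystal.wt B b) (GlCrystal.wt C c) (GlCrystal.wt D d) }
  ; e-comm = λ i → Associativity.e-assoc (strings B i) (strings C i) (strings D i)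
  ; f-comm = λ i → Associativity.f-assoc (strings B i) (strings C i) (strings D i)
  }

-- √q_n-crystals

module _ {k : ℕ} where

  Vanishes₁₂ : Wt k → Set
  Vanishes₁₂ w = wt₁ w ≡ 0 × wt₂ w ≡ 0

  vanishes₁₂ᵇ : Wt k → Bool
  vanishes₁₂ᵇ w = (wt₁ w ≡ᵇ 0) ∧ (wt₂ w ≡ᵇ 0)

  vanishes₁₂ᵇ-reflects : (w : Wt k) → Reflects (Vanishes₁₂ w) (vanishes₁₂ᵇ w)
  vanishes₁₂ᵇ-reflects w = ≡0-reflects (wt₁ w) ×-reflects ≡0-reflects (wt₂ w)
    where
    ≡0-reflects : ∀ m → Reflects (m ≡ 0) (m ≡ᵇ 0)
    ≡0-reflects m = fromEquivalence (≡ᵇ⇒≡ m 0) (≡⇒≡ᵇ m 0)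

  vanishes₁₂? : (w : Wt k) → Dec (Vanishes₁₂ w)
  vanishes₁₂? w = vanishes₁₂ᵇ w because vanishes₁₂ᵇ-reflects w

  Vanishes₁₂-⊕ : (u v : Wt k) → Vanishes₁₂ (u ⊕ v) ⇔ (Vanishes₁₂ u × Vanishes₁₂ v)
  Vanishes₁₂-⊕ u v = mk⇔
    (λ (u₁+v₁≡0 , u₂+v₂≡0) → let s₁ = trans (sym (lookup-⊕ u v zero)) u₁+v₁≡0
                                 s₂ = trans (sym (lookup-⊕ u v (suc zero))) u₂+v₂≡0
                             in (m+n≡0⇒m≡0 (wt₁ u) s₁ , m+n≡0⇒m≡0 (wt₂ u) s₂)
                              , (m+n≡0⇒n≡0 (wt₁ u) s₁ , m+n≡0⇒n≡0 (wt₂ u) s₂))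
    (λ ((u₁≡0 , u₂≡0) , (v₁≡0 , v₂≡0)) → trans (lookup-⊕ u v zero) (cong₂ _+_ u₁≡0 v₁≡0)
                                       , trans (lookup-⊕ u v (suc zero)) (cong₂ _+_ u₂≡0 v₂≡0))

  vanishes₁₂ᵇ-⊕-unit : ∀ {j} (w : Wt k) → 2 ≤ toℕ j → vanishes₁₂ᵇ (w ⊕ unit j) ≡ vanishes₁₂ᵇ w
  vanishes₁₂ᵇ-⊕-unit {suc (suc j)} w _
    rewrite lookup-⊕ w (unit (suc (suc j))) zero | lookup-⊕ w (unit (suc (suc j))) (suc zero)
          | +-identityʳ (wt₁ w) | +-identityʳ (wt₂ w) = refl
  vanishes₁₂ᵇ-⊕-unit {suc zero} _ (s≤s ())

strings̅ : ∀ {k} (Q : QCrystal k) → Seminormal (QCrystal.Carrier Q)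
strings̅ Q = record
  { e = e̅ ; f = f̅ ; ε = ε̅ ; φ = φ̅ ; ε-sup = ε̅-sup ; φ-sup = φ̅-sup ; e⇔f = e̅⇔f̅ }
  where open QCrystal Q

module QCrystalProperties {k : ℕ} (Q : QCrystal k) where
  open QCrystal Q
  open GlCrystal (gl Q) using (ε; e⇔f; wt-even; wt-odd)
  private
    module Q̅ = Seminormal (strings̅ Q)

  e̅-leaves-Vanishes₁₂ : ∀ {b b′} → e̅ b ≡ just b′ → ¬ Vanishes₁₂ (wt b′)
  e̅-leaves-Vanishes₁₂ {b′ = b′} e̅b (w₁≡0 , w₂≡0) =
    contradiction (trans (sym (Q̅.φ-after-e e̅b)) (m+n≡0⇒n≡0 (ε̅ b′) (sum-zero b′ w₁≡0 w₂≡0))) λ ()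

  f̅-leaves-Vanishes₁₂ : ∀ {b b′} → f̅ b ≡ just b′ → ¬ Vanishes₁₂ (wt b′)
  f̅-leaves-Vanishes₁₂ {b′ = b′} f̅b (w₁≡0 , w₂≡0) =
    contradiction (trans (sym (Q̅.ε-after-f f̅b)) (m+n≡0⇒m≡0 (ε̅ b′) (sum-zero b′ w₁≡0 w₂≡0))) λ ()

  e-keeps-vanishes₁₂ᵇ : ∀ i → 2 ≤ toℕ i → ∀ {b b′} → e i b ≡ just b′ →
                        vanishes₁₂ᵇ (wt b′) ≡ vanishes₁₂ᵇ (wt b)
  e-keeps-vanishes₁₂ᵇ i 2≤i {b} {b′} eb with even-or-odd (ε i b)
  ... | inj₁ even = trans (cong vanishes₁₂ᵇ (wt-even i b b′ eb even))
                          (vanishes₁₂ᵇ-⊕-unit (wt b) (subst (2 ≤_) (sym (toℕ-inject₁ i)) 2≤i))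
  ... | inj₂ odd  = sym (trans (cong vanishes₁₂ᵇ (wt-odd i b b′ eb odd))
                               (vanishes₁₂ᵇ-⊕-unit (wt b′) (m≤n⇒m≤1+n 2≤i)))

  f-keeps-vanishes₁₂ᵇ : ∀ i → 2 ≤ toℕ i → ∀ {b b′} → f i b ≡ just b′ →
                        vanishes₁₂ᵇ (wt b′) ≡ vanishes₁₂ᵇ (wt b)
  f-keeps-vanishes₁₂ᵇ i 2≤i {b} {b′} fb = sym (e-keeps-vanishes₁₂ᵇ i 2≤i (from (e⇔f i b′ b) fb))

module QTensor {k : ℕ} (B C : QCrystal k) where
  private
    module B = QCrystal B
    module C = QCrystal C
    module Bᴳ = GlCrystal (gl B)
    module Cᴳ = GlCrystal (gl C)
    module PB = QCrystalProperties B

  ζ : B.Carrier → C.Carrier → Bool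
  ζ b _ = vanishes₁₂ᵇ (B.wt b)

  pick : {X : Set} → B.Carrier → X → X → X
  pick b x y = if vanishes₁₂ᵇ (B.wt b) then y else x

  pick-right : ∀ {X : Set} {b} {x y : X} → Vanishes₁₂ (B.wt b) → pick b x y ≡ y
  pick-right {b = b} V rewrite det (vanishes₁₂ᵇ-reflects (B.wt b)) (ofʸ V) = refl

  pick-left : ∀ {X : Set} {b} {x y : X} → ¬ Vanishes₁₂ (B.wt b) → pick b x y ≡ x
  pick-left {b = b} ¬V rewrite det (vanishes₁₂ᵇ-reflects (B.wt b)) (ofⁿ ¬V) = refl

  picked : (B.Carrier → ℕ) → (C.Carrier → ℕ) → B.Carrier × C.Carrier → ℕ
  picked μ ν (b , c) = pick b (μ b) (ν c)

  module _ {g : B.Carrier → Maybe B.Carrier} {h : C.Carrier → Maybe C.Carrier} where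
    private
      module G = Choose ζ g h

    picked-height : ∀ {μ ν} → IsHeight g μ → IsHeight h ν →
                    (∀ {b b′} → g b ≡ just b′ → ¬ Vanishes₁₂ (B.wt b′)) →
                    IsHeight (choose ζ g h) (picked μ ν)
    picked-height {μ} {ν} heightᵍ heightʰ leaves = record { step = step ; stop = stop }
      where
      module Hᵍ = IsHeight heightᵍ
      module Hʰ = IsHeight heightʰ
      step : ∀ {p q} → choose ζ g h p ≡ just q → picked μ ν p ≡ suc (picked μ ν q)
      step {b , c} eq with G.just-cases (vanishes₁₂ᵇ-reflects (B.wt b)) eq
      ... | inj₁ (V , c′ , hc , refl) =
        trans (pick-right V) (trans (Hʰ.step hc) (cong suc (sym (pick-right V))))
      ... | inj₂ (¬V , b′ , gb , refl) =
        trans (pick-left ¬V) (trans (Hᵍ.step gb) (cong suc (sym (pick-left (leaves gb)))))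
      stop : ∀ {p} → choose ζ g h p ≡ nothing → picked μ ν p ≡ 0
      stop {b , c} eq with G.nothing-cases (vanishes₁₂ᵇ-reflects (B.wt b)) eq
      ... | inj₁ (V , hc)  = trans (pick-right V) (Hʰ.stop hc)
      ... | inj₂ (¬V , gb) = trans (pick-left ¬V) (Hᵍ.stop gb)

    partial-inverse : {g′ : B.Carrier → Maybe B.Carrier} {h′ : C.Carrier → Maybe C.Carrier} →
                      (∀ {b b′} → g b ≡ just b′ → g′ b′ ≡ just b) →
                      (∀ {c c′} → h c ≡ just c′ → h′ c′ ≡ just c) →
                      (∀ {b b′} → g b ≡ just b′ → ¬ Vanishes₁₂ (B.wt b′)) →
                      ∀ {p q} → choose ζ g h p ≡ just q → choose ζ g′ h′ q ≡ just p
    partial-inverse {g′} {h′} g⇒g′ h⇒h′ leaves {b , c} eq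
      with G.just-cases (vanishes₁₂ᵇ-reflects (B.wt b)) eq
    ... | inj₁ (V , c′ , hc , refl) =
      trans (Choose.at-right ζ g′ h′ (vanishes₁₂ᵇ-reflects (B.wt b)) V)
            (cong (map (b ,_)) (h⇒h′ hc))
    ... | inj₂ (¬V , b′ , gb , refl) =
      trans (Choose.at-left ζ g′ h′ (vanishes₁₂ᵇ-reflects (B.wt b′)) (leaves gb))
            (cong (map (_, c)) (g⇒g′ gb))

  module _ {b : B.Carrier} {c : C.Carrier} where

    e̅-right : Vanishes₁₂ (B.wt b) → e̅⊗ B C (b , c) ≡ map (b ,_) (C.e̅ c)
    e̅-right = Choose.at-right ζ B.e̅ C.e̅ (vanishes₁₂ᵇ-reflects (B.wt b))

    e̅-left : ¬ Vanishes₁₂ (B.wt b) → e̅⊗ B C (b , c) ≡ map (_, c) (B.e̅ b)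
    e̅-left = Choose.at-left ζ B.e̅ C.e̅ (vanishes₁₂ᵇ-reflects (B.wt b))

  commute : (_◃_ : ℕ → ℕ → Bool) {i : Fin (suc k)}
            {g̅ᴮ gᴮ : B.Carrier → Maybe B.Carrier} {g̅ᶜ gᶜ : C.Carrier → Maybe C.Carrier} →
            Commute g̅ᴮ gᴮ → Commute g̅ᶜ gᶜ →
            PreservesStrings g̅ᴮ (strings (gl B) i) → PreservesStrings g̅ᶜ (strings (gl C) i) →
            (∀ {b b′} → gᴮ b ≡ just b′ → vanishes₁₂ᵇ (B.wt b′) ≡ vanishes₁₂ᵇ (B.wt b)) →
            Commute (choose ζ g̅ᴮ g̅ᶜ) (choose (λ b c → Bᴳ.ε i b ◃ Cᴳ.φ i c) gᴮ gᶜ)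
  commute _◃_ {i} {g̅ᴮ} {gᴮ} {g̅ᶜ} {gᶜ} commᴮ commᶜ presᴮ presᶜ keeps =
    choose-comm {κ = ζ} {κ} {g̅ᴮ} {gᴮ} {g̅ᶜ} {gᶜ} commᴮ commᶜ keeps-κ keeps-ζ
    where
    κ : B.Carrier → C.Carrier → Bool
    κ b c = Bᴳ.ε i b ◃ Cᴳ.φ i c
    keeps-κ : ∀ {p q} → choose ζ g̅ᴮ g̅ᶜ p ≡ just q → uncurry κ q ≡ uncurry κ p
    keeps-κ = Choose.preserves ζ g̅ᴮ g̅ᶜ (uncurry κ)
      (λ c g̅b → cong (_◃ Cᴳ.φ i c) (proj₁ (presᴮ _ _ g̅b)))
      (λ b g̅c → cong (Bᴳ.ε i b ◃_) (proj₂ (presᶜ _ _ g̅c)))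
    keeps-ζ : ∀ {p q} → choose κ gᴮ gᶜ p ≡ just q → uncurry ζ q ≡ uncurry ζ p
    keeps-ζ = Choose.preserves κ gᴮ gᶜ (uncurry ζ) (λ _ gb → keeps gb) (λ _ _ → refl)

  sum-zero : ∀ p → wt₁ (wt⊗ (gl B) (gl C) p) ≡ 0 → wt₂ (wt⊗ (gl B) (gl C) p) ≡ 0 →
             picked B.ε̅ C.ε̅ p + picked B.φ̅ C.φ̅ p ≡ 0
  sum-zero (b , c) w₁≡0 w₂≡0 with to (Vanishes₁₂-⊕ (B.wt b) (C.wt c)) (w₁≡0 , w₂≡0)
  ... | Vb , (c₁≡0 , c₂≡0) = trans (cong₂ _+_ (pick-right Vb) (pick-right Vb)) (C.sum-zero c c₁≡0 c₂≡0)

  sum-two : ∀ p → ¬ Vanishes₁₂ (wt⊗ (gl B) (gl C) p) → picked B.ε̅ C.ε̅ p + picked B.φ̅ C.φ̅ p ≡ 2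
  sum-two (b , c) ¬V with vanishes₁₂? (B.wt b)
  ... | yes Vb = trans (cong₂ _+_ (pick-right Vb) (pick-right Vb))
                       (C.sum-two c (λ Vc → ¬V (from (Vanishes₁₂-⊕ (B.wt b) (C.wt c)) (Vb , Vc))))
  ... | no ¬Vb = trans (cong₂ _+_ (pick-left ¬Vb) (pick-left ¬Vb)) (B.sum-two b ¬Vb)

  wt-two : ∀ p q → e̅⊗ B C p ≡ just q → picked B.ε̅ C.ε̅ p ≡ 2 →
           wt⊗ (gl B) (gl C) q ≡ wt⊗ (gl B) (gl C) p ⊕ unit zero
  wt-two (b , c) q eq two with Choose.just-cases ζ B.e̅ C.e̅ (vanishes₁₂ᵇ-reflects (B.wt b)) eq
  ... | inj₁ (V , c′ , e̅c , refl)  = ⊕-shiftʳ (C.wt-two c c′ e̅c (trans (sym (pick-right V)) two))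
  ... | inj₂ (¬V , b′ , e̅b , refl) = ⊕-shiftˡ (B.wt-two b b′ e̅b (trans (sym (pick-left ¬V)) two))

  wt-one : ∀ p q → e̅⊗ B C p ≡ just q → picked B.ε̅ C.ε̅ p ≡ 1 →
           wt⊗ (gl B) (gl C) p ≡ wt⊗ (gl B) (gl C) q ⊕ unit (suc zero)
  wt-one (b , c) q eq one with Choose.just-cases ζ B.e̅ C.e̅ (vanishes₁₂ᵇ-reflects (B.wt b)) eq
  ... | inj₁ (V , c′ , e̅c , refl)  = ⊕-shiftʳ (C.wt-one c c′ e̅c (trans (sym (pick-right V)) one))
  ... | inj₂ (¬V , b′ , e̅b , refl) = ⊕-shiftˡ (B.wt-one b b′ e̅b (trans (sym (pick-left ¬V)) one))

  isQCrystal : IsQCrystal (wt⊗ (gl B) (gl C)) (e⊗ (gl B) (gl C)) (f⊗ (gl B) (gl C)) (e̅⊗ B C) (f̅⊗ B C)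
  isQCrystal = record
    { isGl = glTensor (gl B) (gl C)
    ; ε̅ = picked B.ε̅ C.ε̅
    ; φ̅ = picked B.φ̅ C.φ̅
    ; ε̅-sup = height⇒IsSup (picked-height (IsSup⇒height B.ε̅-sup) (IsSup⇒height C.ε̅-sup)
                                          PB.e̅-leaves-Vanishes₁₂)
    ; φ̅-sup = height⇒IsSup (picked-height (IsSup⇒height B.φ̅-sup) (IsSup⇒height C.φ̅-sup)
                                          PB.f̅-leaves-Vanishes₁₂)
    ; comm-e̅e = λ i 2≤i → commute _≤ᵇ_ (B.comm-e̅e i 2≤i) (C.comm-e̅e i 2≤i)
                                        (B.pres-e̅ i 2≤i) (C.pres-e̅ i 2≤i) (PB.e-keeps-vanishes₁₂ᵇ i 2≤i)
    ; comm-e̅f = λ i 2≤i → commute _<ᵇ_ (B.comm-e̅f i 2≤i) (C.comm-e̅f i 2≤i)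
                                        (B.pres-e̅ i 2≤i) (C.pres-e̅ i 2≤i) (PB.f-keeps-vanishes₁₂ᵇ i 2≤i)
    ; comm-f̅e = λ i 2≤i → commute _≤ᵇ_ (B.comm-f̅e i 2≤i) (C.comm-f̅e i 2≤i)
                                        (B.pres-f̅ i 2≤i) (C.pres-f̅ i 2≤i) (PB.e-keeps-vanishes₁₂ᵇ i 2≤i)
    ; comm-f̅f = λ i 2≤i → commute _<ᵇ_ (B.comm-f̅f i 2≤i) (C.comm-f̅f i 2≤i)
                                        (B.pres-f̅ i 2≤i) (C.pres-f̅ i 2≤i) (PB.f-keeps-vanishes₁₂ᵇ i 2≤i)
    ; pres-e̅ = λ i 2≤i → preserves i (B.pres-e̅ i 2≤i) (C.pres-e̅ i 2≤i)
    ; pres-f̅ = λ i 2≤i → preserves i (B.pres-f̅ i 2≤i) (C.pres-f̅ i 2≤i)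
    ; sum-zero = sum-zero
    ; sum-two = sum-two
    ; e̅⇔f̅ = λ _ _ →
        mk⇔ (partial-inverse (to (B.e̅⇔f̅ _ _)) (to (C.e̅⇔f̅ _ _)) PB.e̅-leaves-Vanishes₁₂)
            (partial-inverse (from (B.e̅⇔f̅ _ _)) (from (C.e̅⇔f̅ _ _)) PB.f̅-leaves-Vanishes₁₂)
    ; wt-two = wt-two
    ; wt-one = wt-one
    }
    where
    preserves : ∀ i {g̅ᴮ : B.Carrier → Maybe B.Carrier} {g̅ᶜ : C.Carrier → Maybe C.Carrier} →
                PreservesStrings g̅ᴮ (strings (gl B) i) → PreservesStrings g̅ᶜ (strings (gl C) i) →
                PreservesStrings (choose ζ g̅ᴮ g̅ᶜ) (strings (gl B) i ⊗ strings (gl C) i)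
    preserves i = choose-preserves-strings {S = strings (gl B) i} {strings (gl C) i}

qTensor : ∀ {k} → QTensorLaw k
qTensor = QTensor.isQCrystal

module QAssociativity {k : ℕ} (B C D : QCrystal k) where
  private
    module B = QCrystal B
    module C = QCrystal C
    module D = QCrystal D
    B⊗C C⊗D : QCrystal k
    B⊗C = tensorQ qTensor B C
    C⊗D = tensorQ qTensor C D
    module [B⊗C]⊗D = QTensor B⊗C D
    module B⊗C = QTensor B C
    module C⊗D = QTensor C D
    module B⊗[C⊗D] = QTensor B C⊗D
    open ≡-Reasoning

  e̅-assoc : Intertwines assoc (QCrystal.e̅ (tensorQ qTensor B C⊗D)) (QCrystal.e̅ (tensorQ qTensor B⊗C D))
  e̅-assoc (b , c , d) with vanishes₁₂? (B.wt b) | vanishes₁₂? (C.wt c)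
  ... | yes Vb | yes Vc = begin
    e̅⊗ B⊗C D ((b , c) , d)
      ≡⟨ [B⊗C]⊗D.e̅-right (from (Vanishes₁₂-⊕ (B.wt b) (C.wt c)) (Vb , Vc)) ⟩
    map ((b , c) ,_) (D.e̅ d)
      ≡⟨ map-assoc₃ (D.e̅ d) ⟩
    map assoc (map (b ,_) (map (c ,_) (D.e̅ d)))
      ≡⟨ cong (λ m → map assoc (map (b ,_) m)) (C⊗D.e̅-right Vc) ⟨
    map assoc (map (b ,_) (e̅⊗ C D (c , d)))
      ≡⟨ cong (map assoc) (B⊗[C⊗D].e̅-right Vb) ⟨
    map assoc (e̅⊗ B C⊗D (b , c , d)) ∎
  ... | yes Vb | no ¬Vc = begin
    e̅⊗ B⊗C D ((b , c) , d)
      ≡⟨ [B⊗C]⊗D.e̅-left (¬Vc ∘ proj₂ ∘ to (Vanishes₁₂-⊕ (B.wt b) (C.wt c))) ⟩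
    map (_, d) (e̅⊗ B C (b , c))
      ≡⟨ cong (map (_, d)) (B⊗C.e̅-right Vb) ⟩
    map (_, d) (map (b ,_) (C.e̅ c))
      ≡⟨ map-assoc₂ (C.e̅ c) ⟩
    map assoc (map (b ,_) (map (_, d) (C.e̅ c)))
      ≡⟨ cong (λ m → map assoc (map (b ,_) m)) (C⊗D.e̅-left ¬Vc) ⟨
    map assoc (map (b ,_) (e̅⊗ C D (c , d)))
      ≡⟨ cong (map assoc) (B⊗[C⊗D].e̅-right Vb) ⟨
    map assoc (e̅⊗ B C⊗D (b , c , d)) ∎
  ... | no ¬Vb | _ = begin
    e̅⊗ B⊗C D ((b , c) , d)
      ≡⟨ [B⊗C]⊗D.e̅-left (¬Vb ∘ proj₁ ∘ to (Vanishes₁₂-⊕ (B.wt b) (C.wt c))) ⟩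
    map (_, d) (e̅⊗ B C (b , c))
      ≡⟨ cong (map (_, d)) (B⊗C.e̅-left ¬Vb) ⟩
    map (_, d) (map (_, c) (B.e̅ b))
      ≡⟨ map-assoc₁ (B.e̅ b) ⟩
    map assoc (map (_, (c , d)) (B.e̅ b))
      ≡⟨ cong (map assoc) (B⊗[C⊗D].e̅-left ¬Vb) ⟨
    map assoc (e̅⊗ B C⊗D (b , c , d)) ∎

qAssoc : ∀ {k} (B C D : QCrystal k) →
         IsQIso (tensorQ qTensor B (tensorQ qTensor C D)) (tensorQ qTensor (tensorQ qTensor B C) D) assoc
qAssoc B C D = record
  { isGlIso = glAssoc (gl B) (gl C) (gl D)
  ; e̅-comm = e̅-assoc
  ; f̅-comm = intertwines-partial-inverse assoc-bijective
               (QCrystal.e̅⇔f̅ (tensorQ qTensor B (tensorQ qTensor C D)))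
               (QCrystal.e̅⇔f̅ (tensorQ qTensor (tensorQ qTensor B C) D)) e̅-assoc
  }
  where open QAssociativity B C D

theorem3p27 : (k : ℕ) →
    Σ[ tens ∈ GlTensorLaw k ]
    Σ[ tensQ ∈ QTensorLaw k ]
      ((∀ (B C D : GlCrystal k) →
          IsGlIso (tensorGl tens B (tensorGl tens C D))
                  (tensorGl tens (tensorGl tens B C) D) assoc)
      × (∀ (B C D : QCrystal k) →
          IsQIso (tensorQ tensQ B (tensorQ tensQ C D))
                 (tensorQ tensQ (tensorQ tensQ B C) D) assoc))
theorem3p27 k = glTensor , qTensor , glAssoc , qAssoc
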